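{- Let $n>1$ and $k$ be positive integers, and let $\chi_1,\chi_2:[n]\times[n]\to[k]$ be two $k$-colorings of the grid $G_{n,n}$ (i.e. colorings with no monochromatic rectangle). Let $H_1$ and $H_2$ be the vertex-colored graphs corresponding to $\chi_1$ and $\chi_2$. If $H_1$ and $H_2$ are isomorphic as vertex-colored graphs, then $\chi_1$ and $\chi_2$ are isomorphic grid colorings.
   Context: $G_{n,n}$ is the $n\times n$ grid with cells $[n]\times[n]$. A monochromatic rectangle for a coloring $\chi$ is a set of four distinct cells $(a,b),(a,d),(c,b),(c,d)$ all receiving the same color; a $k$-coloring of $G_{n,n}$ is a map $\chi:[n]\times[n]\to[k]$ with no monochromatic rectangle. The graph corresponding to a coloring $\chi$ has vertex set $[n]\times[n]$, each vertex carrying the color $\chi$ assigns to that cell; two distinct vertices $(a,b),(c,d)$ are adjacent iff $a=c$ or $b=d$; there are no loops. An isomorphism of vertex-colored graphs is an adjacency-preserving bijection of the vertex sets that maps each vertex to a vertex of the same color. Two colorings of $G_{n,n}$ are isomorphic if one can be obtained from the other by a finite sequence of the operations: permuting the colors; permuting the rows; permuting the columns; transposing the grid (flip along the main diagonal, $(i,j)\mapsto(j,i)$). -}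

module Defs where

open import Data.Nat using (ℕ)
open import Data.Fin using (Fin)
open import Data.Product using (_×_; _,_; ∃)
open import Data.Sum using (_⊎_)
open import Relation.Nullary using (¬_)
open import Relation.Binary.PropositionalEquality using (_≡_)
open import Relation.Binary.Construct.Closure.ReflexiveTransitive using (Star)
open import Function.Bundles using (_↔_; _⇔_; Inverse)

Coloring : ℕ → ℕ → Set
Coloring n k = Fin n → Fin n → Fin k

-- Cells (a,b),(a,d),(c,b),(c,d) are four distinct cells iff a ≢ c and b ≢ d.
MonoRectangle : ∀ {n k} → Coloring n k → Set
MonoRectangle {n} χ =
  ∃ λ (a : Fin n) → ∃ λ (b : Fin n) → ∃ λ (c : Fin n) → ∃ λ (d : Fin n) →
    ¬ (a ≡ c) × ¬ (b ≡ d) ×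
    χ a d ≡ χ a b × χ c b ≡ χ a b × χ c d ≡ χ a b

IsKColoring : ∀ {n k} → Coloring n k → Set
IsKColoring χ = ¬ MonoRectangle χ

Cell : ℕ → Set
Cell n = Fin n × Fin n

Adj : ∀ {n} → Cell n → Cell n → Set
Adj (a , b) (c , d) = ¬ ((a , b) ≡ (c , d)) × (a ≡ c ⊎ b ≡ d)

ColoredGraphIso : ∀ {n k} → Coloring n k → Coloring n k → Set
ColoredGraphIso {n} χ₁ χ₂ =
  ∃ λ (f : Cell n ↔ Cell n) →
    (∀ u v → Adj u v ⇔ Adj (Inverse.to f u) (Inverse.to f v)) ×
    (∀ u → χ₂ (Data.Product.proj₁ (Inverse.to f u)) (Data.Product.proj₂ (Inverse.to f u))
           ≡ χ₁ (Data.Product.proj₁ u) (Data.Product.proj₂ u))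

data Step {n k : ℕ} (χ χ' : Coloring n k) : Set where
  permColors : (σ : Fin k ↔ Fin k) → (∀ i j → χ' i j ≡ Inverse.to σ (χ i j)) → Step χ χ'
  permRows   : (π : Fin n ↔ Fin n) → (∀ i j → χ' i j ≡ χ (Inverse.to π i) j) → Step χ χ'
  permCols   : (π : Fin n ↔ Fin n) → (∀ i j → χ' i j ≡ χ i (Inverse.to π j)) → Step χ χ'
  transpose  : (∀ i j → χ' i j ≡ χ j i) → Step χ χ'

IsoColoring : ∀ {n k} → Coloring n k → Coloring n k → Set
IsoColoring = Star Step

-- An isomorphism of the colored graphs is a color-preserving automorphism of the rook's graph
-- on [n]×[n]. Two cells in different rows and different columns are never adjacent, so once an
-- automorphism maps two cells of one row into a common row, it maps every row into a row and
-- every column into a column: it is (a , b) ↦ (π a , σ b) for permutations π, σ of [n]. The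
-- images of two cells of a row are adjacent, so they share a row or, after composing with the
-- transpose, they do. Hence χ₂ arises from χ₁ by permuting rows and columns, possibly followed
-- by a transpose.
module Submission where

open import Defs
open import Data.Nat using (ℕ; _≤_; suc; s≤s; z≤n)
open import Data.Fin using (Fin; zero; suc)
open import Data.Fin.Properties using (_≟_; 0≢1+n)
open import Data.Product using (_×_; _,_; proj₁; proj₂; swap)
open import Data.Product.Algebra using (×-comm)
open import Data.Sum using (_⊎_; inj₁; inj₂)
open import Data.Empty using (⊥-elim)
open import Function.Base using (_∘_)
open import Function.Bundles using (_↔_; _⇔_; Inverse; Equivalence; Injection; mk↔ₛ′; mk⇔)
open import Function.Properties.Inverse using (↔⇒↣)
open import Function.Construct.Composition using (_↔-∘_)
open import Function.Construct.Symmetry using (↔-sym)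
open import Relation.Nullary using (¬_; yes; no)
open import Relation.Binary.PropositionalEquality
  using (_≡_; refl; sym; trans; cong; cong₂)
open import Relation.Binary.Construct.Closure.ReflexiveTransitive using (ε; _◅_; _◅◅_)

open Inverse using (to; from; strictlyInverseˡ; strictlyInverseʳ)

IsRookAutomorphism : ∀ {n} → Cell n ↔ Cell n → Set
IsRookAutomorphism {n} f = ∀ (u v : Cell n) → Adj u v ⇔ Adj (to f u) (to f v)

corners-nonadjacent : ∀ {n} {a b c d : Fin n} → ¬ a ≡ c → ¬ b ≡ d → ¬ Adj (a , d) (c , b)
corners-nonadjacent a≢c b≢d (_ , inj₁ a≡c) = a≢c a≡c
corners-nonadjacent a≢c b≢d (_ , inj₂ d≡b) = b≢d (sym d≡b)

Adj-swap : ∀ {n} {u v : Cell n} → Adj u v → Adj (swap u) (swap v)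
Adj-swap (u≢v , inj₁ sameRow) = u≢v ∘ cong swap , inj₂ sameRow
Adj-swap (u≢v , inj₂ sameCol) = u≢v ∘ cong swap , inj₁ sameCol

transpose↔ : ∀ {n} → Cell n ↔ Cell n
transpose↔ = ×-comm _ _

transpose-isRookAutomorphism : ∀ {n} {f : Cell n ↔ Cell n} →
  IsRookAutomorphism f → IsRookAutomorphism (transpose↔ ↔-∘ f)
transpose-isRookAutomorphism auto u v =
  mk⇔ (Adj-swap ∘ Equivalence.to (auto u v)) (Equivalence.from (auto u v) ∘ Adj-swap)

module LinesToLines {n} (f : Cell n ↔ Cell n) (auto : IsRookAutomorphism f)
  {z o : Fin n} (z≢o : ¬ z ≡ o) (base : proj₁ (to f (z , z)) ≡ proj₁ (to f (z , o))) where

  row col : Cell n → Fin n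
  row u = proj₁ (to f u)
  col u = proj₂ (to f u)

  image-adjacent : ∀ {u v} → Adj u v → row u ≡ row v ⊎ col u ≡ col v
  image-adjacent u~v = proj₂ (Equivalence.to (auto _ _) u~v)

  images-distinct : ∀ {u v} → ¬ u ≡ v → ¬ to f u ≡ to f v
  images-distinct u≢v = u≢v ∘ Injection.injective (↔⇒↣ f)

  corner-images-nonadjacent : ∀ {a b c d} → ¬ a ≡ c → ¬ b ≡ d →
    ¬ Adj (to f (a , d)) (to f (c , b))
  corner-images-nonadjacent a≢c b≢d = corners-nonadjacent a≢c b≢d ∘ Equivalence.from (auto _ _)

  column-turn : ∀ {a b c d} → ¬ a ≡ c → ¬ b ≡ d →
    row (a , b) ≡ row (a , d) → col (a , b) ≡ col (c , b)
  column-turn {a} {b} {c} a≢c b≢d sameRow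
    with image-adjacent {a , b} {c , b} (a≢c ∘ cong proj₁ , inj₂ refl)
  ... | inj₂ sameCol = sameCol
  ... | inj₁ sameRow′ = ⊥-elim (corner-images-nonadjacent a≢c b≢d
          (images-distinct (a≢c ∘ cong proj₁) , inj₁ (trans (sym sameRow) sameRow′)))

  row-turn : ∀ {a b c} → ¬ a ≡ c → col (a , b) ≡ col (c , b) → ∀ d → row (a , b) ≡ row (a , d)
  row-turn {a} {b} a≢c sameCol d with b ≟ d
  ... | yes refl = refl
  ... | no b≢d with image-adjacent {a , b} {a , d} (b≢d ∘ cong proj₂ , inj₁ refl)
  ...   | inj₁ sameRow = sameRow
  ...   | inj₂ sameCol′ = ⊥-elim (corner-images-nonadjacent a≢c b≢d
            (images-distinct (a≢c ∘ cong proj₁) , inj₂ (trans (sym sameCol′) sameCol)))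

  other : Fin n → Fin n
  other x with x ≟ z
  ... | yes _ = o
  ... | no _ = z

  other≢ : ∀ x → ¬ x ≡ other x
  other≢ x with x ≟ z
  ... | yes refl = z≢o
  ... | no x≢z = x≢z

  col-constant-on-column-z : ∀ c → col (z , z) ≡ col (c , z)
  col-constant-on-column-z c with c ≟ z
  ... | yes refl = refl
  ... | no c≢z = column-turn (c≢z ∘ sym) z≢o base

  row-constant : ∀ a b → row (a , b) ≡ row (a , z)
  row-constant a b = sym (row-turn (other≢ a) sameCol b)
    where
    sameCol : col (a , z) ≡ col (other a , z)
    sameCol = trans (sym (col-constant-on-column-z a)) (col-constant-on-column-z (other a))

  col-constant : ∀ a b → col (a , b) ≡ col (z , b)
  col-constant a b with a ≟ z
  ... | yes refl = refl
  ... | no a≢z = column-turn a≢z (other≢ b)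
                   (trans (row-constant a b) (sym (row-constant a (other b))))

  to-split : ∀ a b → to f (a , b) ≡ (row (a , z) , col (z , b))
  to-split a b = cong₂ _,_ (row-constant a b) (col-constant a b)

module _ {A B C D : Set} (f : (A × B) ↔ (C × D)) {π : A → C} {σ : B → D}
         (split : ∀ a b → to f (a , b) ≡ (π a , σ b)) where

  to-from-split : ∀ y → (π (proj₁ (from f y)) , σ (proj₂ (from f y))) ≡ y
  to-from-split y = trans (sym (split _ _)) (strictlyInverseˡ f y)

  from-split : ∀ a b → from f (π a , σ b) ≡ (a , b)
  from-split a b = trans (cong (from f) (sym (split a b))) (strictlyInverseʳ f (a , b))

  factorˡ↔ : B → A ↔ C
  factorˡ↔ b₀ = mk↔ₛ′ π (λ i → proj₁ (from f (i , σ b₀)))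
    (λ i → cong proj₁ (to-from-split (i , σ b₀)))
    (λ a → cong proj₁ (from-split a b₀))

  factorʳ↔ : A → B ↔ D
  factorʳ↔ a₀ = mk↔ₛ′ σ (λ j → proj₂ (from f (π a₀ , j)))
    (λ j → cong proj₂ (to-from-split (π a₀ , j)))
    (λ b → cong proj₂ (from-split a₀ b))

permRows-permCols : ∀ {n k} {χ₁ χ₂ : Coloring n k} (π σ : Fin n ↔ Fin n) →
  (∀ a b → χ₂ (to π a) (to σ b) ≡ χ₁ a b) → IsoColoring χ₁ χ₂
permRows-permCols {χ₁ = χ₁} {χ₂} π σ recolored =
  permRows (↔-sym π) (λ _ _ → refl) ◅ permCols (↔-sym σ) recolored′ ◅ ε
  where
  recolored′ : ∀ i j → χ₂ i j ≡ χ₁ (from π i) (from σ j)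
  recolored′ i j = trans (sym (cong₂ χ₂ (strictlyInverseˡ π i) (strictlyInverseˡ σ j)))
                         (recolored (from π i) (from σ j))

rowPreserving⇒IsoColoring : ∀ {n k} {χ₁ χ₂ : Coloring n k} (f : Cell n ↔ Cell n) →
  IsRookAutomorphism f →
  (∀ u → χ₂ (proj₁ (to f u)) (proj₂ (to f u)) ≡ χ₁ (proj₁ u) (proj₂ u)) →
  {z o : Fin n} → ¬ z ≡ o → proj₁ (to f (z , z)) ≡ proj₁ (to f (z , o)) →
  IsoColoring χ₁ χ₂
rowPreserving⇒IsoColoring {χ₁ = χ₁} {χ₂} f auto recolored {z} z≢o base =
  permRows-permCols (factorˡ↔ f to-split z) (factorʳ↔ f to-split z) recolored′
  where
  open LinesToLines f auto z≢o base
  recolored′ : ∀ a b → χ₂ (row (a , z)) (col (z , b)) ≡ χ₁ a b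
  recolored′ a b = trans (cong (λ p → χ₂ (proj₁ p) (proj₂ p)) (sym (to-split a b)))
                         (recolored (a , b))

proposition1 : (n k : ℕ) → 2 ≤ n → 1 ≤ k → (χ₁ χ₂ : Coloring n k) →
    IsKColoring χ₁ → IsKColoring χ₂ → ColoredGraphIso χ₁ χ₂ → IsoColoring χ₁ χ₂
proposition1 (suc (suc _)) _ (s≤s (s≤s z≤n)) _ χ₁ χ₂ _ _ (f , auto , recolored)
  with proj₂ (Equivalence.to (auto (zero , zero) (zero , suc zero)) (0≢1+n ∘ cong proj₂ , inj₁ refl))
... | inj₁ sameRow = rowPreserving⇒IsoColoring f auto recolored 0≢1+n sameRow
... | inj₂ sameCol =
  rowPreserving⇒IsoColoring {χ₂ = λ i j → χ₂ j i}
    (transpose↔ ↔-∘ f) (transpose-isRookAutomorphism {f = f} auto) recolored 0≢1+n sameCol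
  ◅◅ transpose (λ _ _ → refl) ◅ ε
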